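{- Let $H$ be a fixed graph without self-loops, let $G$ be a graph with twin decomposition $\Pi$, and let $\tau(\cdot)$ denote the size of a minimum twin-cover. (i) If $P'\in\Pi$ satisfies $N_G(P')=\emptyset$ and $|P'|\leq\omega(H)$, then $\tau(G-P')\leq\tau(G)$. (ii) If $P'\neq P''\in\Pi$ satisfy $E_G(P',P'')\neq\emptyset$ and $L(P',G)\subseteq\mathrm{span}(L_\Pi(G\setminus E_G(P',P'')))$, then $\tau(G\setminus E_G(P',P''))\leq\tau(G)$.
   Context: All graphs are finite, simple and undirected. Vertices $u,v$ are twins if $N_G[u]=N_G[v]$; a twin decomposition is a partition of $V(G)$ in which two vertices share a part iff they are twins. A twin-cover of $G$ is a set $X\subseteq V(G)$ such that for every edge $\{u,v\}$, $u\in X$ or $v\in X$ or $u,v$ are twins. $N_G(P)$ is the open neighborhood, $E_G(X,Y)$ the set of edges between $X$ and $Y$, $G\setminus F$ is $G$ minus edge set $F$, $\omega$ is the clique number, $\Delta(H)$ the maximum degree, $[n]=\{1,\dots,n\}$. Boolean variables $c_{v,i}$ for vertices $v$ and $i\in V(H)$; polynomials over the integers modulo 2. For $P\subseteq V(G)$, with $d=\Delta(H)$, $L(P,G)$ consists of: (Type 1) for each $S=\{s_1,\dots,s_{d+1}\}\subseteq N_G(P)$ and $X=\{x_1,\dots,x_{d+1}\}\subseteq V(H)$, the constraint $\sum_{i_1,\dots,i_d\in[d+1]\text{ pairwise distinct}}\prod_{k=1}^d c_{s_{i_k},x_k}\equiv 0$; (Type 2) for each $k\in[d]$, $S=\{s_1,\dots,s_k\}\subseteq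 N_G(P)$ of size $k$ and sequence $x_1,\dots,x_k\in V(H)$ with $\omega(H[\bigcap_{i=1}^kN_H(x_i)])<|P|$, the constraint $\prod_{i=1}^k c_{s_i,x_i}\equiv 0$. $L_\Pi(G)=\bigcup_{P\in\Pi}L(P,G)$. $\mathrm{span}$ of a set of polynomials is the set of sums modulo 2 of their coefficient vectors (w.r.t. a fixed ordering of monomials), and $\mathcal{Q}\subseteq\mathrm{span}(\mathcal{P})$ means each $q\in\mathcal{Q}$ has coefficient vector in $\mathrm{span}(\mathcal{P})$. -}

module Defs where

open import Data.Nat using (ℕ; zero; suc; _≤_; _<_; _⊔_)
open import Data.Bool using (Bool; true; false; _∧_; _∨_; not; _xor_; if_then_else_)
open import Data.Bool.Properties using (∧-comm; ∨-comm)
import Data.Bool.Properties as BoolP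
open import Data.Fin using (Fin; inject₁)
import Data.Fin as Fin
open import Data.Fin.Subset using (Subset; _∈_; _∉_; ∣_∣; inside; outside)
open import Data.Vec using (Vec; lookup; tabulate)
open import Data.Vec.Properties using (≡-dec)
import Data.Vec.Functional as VF
open import Data.List using (List; []; _∷_; map; concatMap; foldr; allFin)
open import Data.Bool.ListAction using (all; any)
open import Data.List.Relation.Unary.All using (All)
open import Data.Product using (Σ; ∃; ∃-syntax; _×_; _,_)
open import Data.Sum using (_⊎_)
open import Relation.Nullary using (¬_; does)
open import Relation.Binary.PropositionalEquality using (_≡_; _≢_; refl; cong₂; trans)
open import Function.Bundles using (_⇔_)

-- A graph "on Fin n" has vertex set V ⊆ Fin n
-- (so that vertex deletion stays inside the same ambient type), and an
-- irreflexive symmetric adjacency; only edges inside V count.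

record Graph (n : ℕ) : Set where
  field
    V         : Subset n
    adj       : Fin n → Fin n → Bool
    adj-sym   : ∀ u v → adj u v ≡ adj v u
    adj-irr   : ∀ u → adj u u ≡ false
open Graph public

E : ∀ {n} → Graph n → Fin n → Fin n → Bool
E G u v = lookup (V G) u ∧ (lookup (V G) v ∧ adj G u v)

Vtx : ∀ {n} → Graph n → Fin n → Set
Vtx G u = u ∈ V G

ClosedNbr : ∀ {n} → Graph n → Fin n → Fin n → Set
ClosedNbr G u w = (u ∈ V G × w ≡ u) ⊎ E G u w ≡ true

Twins : ∀ {n} → Graph n → Fin n → Fin n → Set
Twins G u v = ∀ w → ClosedNbr G u w ⇔ ClosedNbr G v w

IsPart : ∀ {n} → Graph n → Subset n → Set
IsPart G P = ∃[ v ] (v ∈ V G × (∀ w → (w ∈ P) ⇔ (w ∈ V G × Twins G v w)))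

InNbr : ∀ {n} → Graph n → Subset n → Fin n → Set
InNbr G P w = w ∉ P × ∃[ u ] (u ∈ P × E G u w ≡ true)

IsTwinCover : ∀ {n} → Graph n → Subset n → Set
IsTwinCover G X = (∀ u → u ∈ X → u ∈ V G) ×
  (∀ u v → E G u v ≡ true → u ∈ X ⊎ v ∈ X ⊎ Twins G u v)

IsTau : ∀ {n} → Graph n → ℕ → Set
IsTau G t = (∃[ X ] (IsTwinCover G X × ∣ X ∣ ≡ t)) ×
  (∀ X → IsTwinCover G X → t ≤ ∣ X ∣)

IsCliqueIn : ∀ {h} → Graph h → (Fin h → Set) → Subset h → Set
IsCliqueIn H T C = (∀ u → u ∈ C → T u) ×
  (∀ u v → u ∈ C → v ∈ C → u ≢ v → E H u v ≡ true)

IsCliqueNumber : ∀ {h} → Graph h → (Fin h → Set) → ℕ → Set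
IsCliqueNumber H T w = (∃[ C ] (IsCliqueIn H T C × ∣ C ∣ ≡ w)) ×
  (∀ C → IsCliqueIn H T C → ∣ C ∣ ≤ w)

deg : ∀ {h} → Graph h → Fin h → ℕ
deg H v = ∣ tabulate (E H v) ∣

Δ : ∀ {h} → Graph h → ℕ
Δ {h} H = foldr (λ v m → deg H v ⊔ m) 0 (allFin h)

_－_ : ∀ {n} → Graph n → Subset n → Graph n
G － P = record
  { V = tabulate (λ u → lookup (V G) u ∧ not (lookup P u))
  ; adj = adj G ; adj-sym = adj-sym G ; adj-irr = adj-irr G }

cross : ∀ {n} → Subset n → Subset n → Fin n → Fin n → Bool
cross P Q u v = (lookup P u ∧ lookup Q v) ∨ (lookup Q u ∧ lookup P v)

cross-sym : ∀ {n} (P Q : Subset n) u v → cross P Q u v ≡ cross P Q v u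
cross-sym P Q u v
  rewrite ∧-comm (lookup P u) (lookup Q v) | ∧-comm (lookup Q u) (lookup P v)
  = ∨-comm (lookup Q v ∧ lookup P u) (lookup P v ∧ lookup Q u)

removeEdges : ∀ {n} → Graph n → Subset n → Subset n → Graph n
removeEdges G P Q = record
  { V = V G
  ; adj = λ u v → adj G u v ∧ not (cross P Q u v)
  ; adj-sym = λ u v → cong₂ (λ a b → a ∧ not b) (adj-sym G u v) (cross-sym P Q u v)
  ; adj-irr = λ u → cong₂ (λ a b → a ∧ b) (adj-irr G u) refl }

EdgesBetweenNonempty : ∀ {n} → Graph n → Subset n → Subset n → Set
EdgesBetweenNonempty G P Q = ∃[ u ] ∃[ v ] (u ∈ P × v ∈ Q × E G u v ≡ true)

-- Polynomials over ℤ/2 in the Boolean variables c_{v,i} (v ∈ Fin n,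
-- i ∈ Fin h).  A monomial is the set of variables occurring in it
-- (multilinear, as c² = c for Boolean variables); a polynomial is a
-- formal sum (list) of monomials; its coefficient vector is taken mod 2.

Mono : ℕ → ℕ → Set
Mono n h = Vec (Vec Bool h) n

Poly : ℕ → ℕ → Set
Poly n h = List (Mono n h)

_≟M_ : ∀ {n h} (m m' : Mono n h) → Relation.Nullary.Dec (m ≡ m')
_≟M_ = ≡-dec (≡-dec BoolP._≟_)

coeff : ∀ {n h} → Poly n h → Mono n h → Bool
coeff p m = foldr (λ m' b → does (m' ≟M m) xor b) false p

prodMono : ∀ {n h k} → (Fin k → Fin n) → (Fin k → Fin h) → Mono n h
prodMono {k = k} s x = tabulate λ v → tabulate λ i →
  any (λ j → does (s j Fin.≟ v) ∧ does (x j Fin.≟ i)) (allFin k)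

allFuns : (d m : ℕ) → List (Fin d → Fin m)
allFuns zero m = (λ ()) ∷ []
allFuns (suc d) m = concatMap (λ a → map (λ f → a VF.∷ f) (allFuns d m)) (allFin m)

injᵇ : ∀ {d m} → (Fin d → Fin m) → Bool
injᵇ {d} f = all (λ i → all (λ j → does (i Fin.≟ j) ∨ not (does (f i Fin.≟ f j))) (allFin d)) (allFin d)

Injective : ∀ {a b} → (Fin a → Fin b) → Set
Injective f = ∀ i j → f i ≡ f j → i ≡ j

type1Poly : ∀ {n h} (d : ℕ) → (Fin (suc d) → Fin n) → (Fin (suc d) → Fin h) → Poly n h
type1Poly d s x = concatMap
  (λ ι → if injᵇ ι then prodMono (λ k → s (ι k)) (λ k → x (inject₁ k)) ∷ [] else [])
  (allFuns d (suc d))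

CommonNbr : ∀ {h k} → Graph h → (Fin k → Fin h) → Fin h → Set
CommonNbr H x w = ∀ j → E H (x j) w ≡ true

data InL {n h} (H : Graph h) (P : Subset n) (G : Graph n) : Poly n h → Set where
  type1 : (s : Fin (suc (Δ H)) → Fin n) → Injective s → (∀ j → InNbr G P (s j)) →
          (x : Fin (suc (Δ H)) → Fin h) → Injective x → (∀ j → x j ∈ V H) →
          InL H P G (type1Poly (Δ H) s x)
  type2 : (k : ℕ) → 1 ≤ k → k ≤ Δ H →
          (s : Fin k → Fin n) → Injective s → (∀ j → InNbr G P (s j)) →
          (x : Fin k → Fin h) → (∀ j → x j ∈ V H) →
          (∃[ w ] (IsCliqueNumber H (CommonNbr H x) w × w < ∣ P ∣)) →
          InL H P G (prodMono s x ∷ [])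

InLΠ : ∀ {n h} → Graph h → (G : Graph n) → (G' : Graph n) → Poly n h → Set
InLΠ H G G' p = ∃[ P ] (IsPart G P × InL H P G' p)

InSpan : ∀ {n h} → (Poly n h → Set) → Poly n h → Set
InSpan 𝒫 q = ∃[ sel ] (All 𝒫 sel ×
  (∀ m → coeff q m ≡ foldr (λ p b → coeff p m xor b) false sel))

-- A twin-cover X of G restricts to one of G' (X ∩ V(G')) whenever G' is obtained from G
-- by deleting edges and vertices in a way that keeps adjacent twins of G twins in G'.
-- Deleting a twin class, or all edges between two twin classes, is such an operation:
-- twins lie in the same classes, so they lose exactly the same neighbours.
module Submission where

open import Defs
open import Data.Nat using (ℕ; _≤_)
open import Data.Nat.Properties using (≤-trans; ≤-reflexive)
open import Data.Bool using (true; false; _∧_; _∨_; not)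
open import Data.Bool.Properties using (⇔→≡)
open import Data.Fin.Subset using (Subset; _∈_; _∩_; ∣_∣)
open import Data.Fin.Subset.Properties using (∣p∩q∣≤∣p∣; x∈p∩q⁺; x∈p∩q⁻)
open import Data.Vec using (lookup)
open import Data.Vec.Properties using ([]=⇒lookup; lookup⇒[]=; lookup∘tabulate)
open import Data.Product using (_×_; _,_; proj₁; proj₂; ∃-syntax)
open import Data.Sum using (_⊎_; inj₁; inj₂)
open import Function.Bundles using (mk⇔; Equivalence)
open import Relation.Nullary using (¬_)
open import Relation.Binary.PropositionalEquality using (_≡_; _≢_; refl; sym; trans; cong₂)

∧-true⁻ : ∀ x y → x ∧ y ≡ true → x ≡ true × y ≡ true
∧-true⁻ true true _ = refl , refl

∧-true⁺ : ∀ {x y} → x ≡ true → y ≡ true → x ∧ y ≡ true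
∧-true⁺ refl refl = refl

not-true⁻ : ∀ x → not x ≡ true → x ≡ false
not-true⁻ false _ = refl

not-false⁺ : ∀ {x} → x ≡ false → not x ≡ true
not-false⁺ refl = refl

module _ {n} (G : Graph n) where

  E⁻ : ∀ {u v} → E G u v ≡ true → u ∈ V G × v ∈ V G × adj G u v ≡ true
  E⁻ {u} {v} e with ∧-true⁻ _ _ e
  ... | u∈V , e′ with ∧-true⁻ _ _ e′
  ...   | v∈V , uv = lookup⇒[]= u (V G) u∈V , lookup⇒[]= v (V G) v∈V , uv

  E⁺ : ∀ {u v} → u ∈ V G → v ∈ V G → adj G u v ≡ true → E G u v ≡ true
  E⁺ u∈V v∈V uv = ∧-true⁺ ([]=⇒lookup u∈V) (∧-true⁺ ([]=⇒lookup v∈V) uv)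

  E-sym : ∀ {u v} → E G u v ≡ true → E G v u ≡ true
  E-sym {u} {v} e with E⁻ e
  ... | u∈V , v∈V , uv = E⁺ v∈V u∈V (trans (adj-sym G v u) uv)

  Twins-sym : ∀ {a b} → Twins G a b → Twins G b a
  Twins-sym ab w = mk⇔ (Equivalence.from (ab w)) (Equivalence.to (ab w))

  Twins-trans : ∀ {a b c} → Twins G a b → Twins G b c → Twins G a c
  Twins-trans ab bc w = mk⇔ (λ x → Equivalence.to (bc w) (Equivalence.to (ab w) x))
                            (λ x → Equivalence.from (ab w) (Equivalence.from (bc w) x))

  IsPart-twin-closed : ∀ {P a b} → IsPart G P → a ∈ P → b ∈ V G → Twins G a b → b ∈ P
  IsPart-twin-closed {a = a} {b} (_ , _ , P⇔) a∈P b∈V ab =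
    Equivalence.from (P⇔ b) (b∈V , Twins-trans (proj₂ (Equivalence.to (P⇔ a) a∈P)) ab)

  IsPart-lookup-twins : ∀ {P a b} → IsPart G P → a ∈ V G → b ∈ V G → Twins G a b →
    lookup P a ≡ lookup P b
  IsPart-lookup-twins {P} {a} {b} part a∈V b∈V ab = ⇔→≡ (mk⇔ a⇒b b⇒a)
    where
    a⇒b : lookup P a ≡ true → lookup P b ≡ true
    a⇒b Pa = []=⇒lookup (IsPart-twin-closed part (lookup⇒[]= a P Pa) b∈V ab)
    b⇒a : lookup P b ≡ true → lookup P a ≡ true
    b⇒a Pb = []=⇒lookup (IsPart-twin-closed part (lookup⇒[]= b P Pb) a∈V (Twins-sym ab))

record TwinPreservingSubgraph {n} (G′ G : Graph n) : Set where
  field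
    edge⊆       : ∀ {u v} → E G′ u v ≡ true → E G u v ≡ true
    twin-extend : ∀ {a b w} → E G′ a b ≡ true → Twins G a b →
                  E G′ a w ≡ true → E G b w ≡ true → E G′ b w ≡ true

module _ {n} {G′ G : Graph n} (sub : TwinPreservingSubgraph G′ G) where
  open TwinPreservingSubgraph sub

  private
    closedNbr-transfer : ∀ {a b} → E G′ a b ≡ true → Twins G a b →
      ∀ w → ClosedNbr G′ a w → ClosedNbr G′ b w
    closedNbr-transfer ab _ w (inj₁ (_ , refl)) = inj₂ (E-sym G′ ab)
    closedNbr-transfer ab tw w (inj₂ aw) with Equivalence.to (tw w) (inj₂ (edge⊆ aw))
    ... | inj₁ (_ , refl) = inj₁ (proj₁ (proj₂ (E⁻ G′ ab)) , refl)
    ... | inj₂ bw = inj₂ (twin-extend ab tw aw bw)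

  adjacent-twins-preserved : ∀ {a b} → E G′ a b ≡ true → Twins G a b → Twins G′ a b
  adjacent-twins-preserved ab tw w =
    mk⇔ (closedNbr-transfer ab tw w) (closedNbr-transfer (E-sym G′ ab) (Twins-sym G tw) w)

  IsTwinCover-restrict : ∀ {X} → IsTwinCover G X → IsTwinCover G′ (X ∩ V G′)
  IsTwinCover-restrict {X} (_ , covers) = (λ _ u∈ → proj₂ (x∈p∩q⁻ X (V G′) u∈)) , covers′
    where
    covers′ : ∀ u v → E G′ u v ≡ true →
      u ∈ X ∩ V G′ ⊎ v ∈ X ∩ V G′ ⊎ Twins G′ u v
    covers′ u v uv with covers u v (edge⊆ uv) | E⁻ G′ uv
    ... | inj₁ u∈X        | u∈V , _ , _ = inj₁ (x∈p∩q⁺ (u∈X , u∈V))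
    ... | inj₂ (inj₁ v∈X) | _ , v∈V , _ = inj₂ (inj₁ (x∈p∩q⁺ (v∈X , v∈V)))
    ... | inj₂ (inj₂ tw)  | _           = inj₂ (inj₂ (adjacent-twins-preserved uv tw))

  IsTau-mono : ∀ {t t′} → IsTau G t → IsTau G′ t′ → t′ ≤ t
  IsTau-mono ((X , cover , ∣X∣≡t) , _) (_ , minimal) =
    ≤-trans (minimal _ (IsTwinCover-restrict cover))
            (≤-trans (∣p∩q∣≤∣p∣ X (V G′)) (≤-reflexive ∣X∣≡t))

deleteVertices-twinPreserving : ∀ {n} (G : Graph n) (P : Subset n) →
  TwinPreservingSubgraph (G － P) G
deleteVertices-twinPreserving G P = record
  { edge⊆       = λ uv → let u∈ , v∈ , a = E⁻ (G － P) uv in E⁺ G (⊆V u∈) (⊆V v∈) a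
  ; twin-extend = λ ab _ aw bw →
      E⁺ (G － P) (proj₁ (proj₂ (E⁻ (G － P) ab))) (proj₁ (proj₂ (E⁻ (G － P) aw)))
                  (proj₂ (proj₂ (E⁻ G bw)))
  }
  where
  ⊆V : ∀ {u} → u ∈ V (G － P) → u ∈ V G
  ⊆V {u} u∈ = lookup⇒[]= u (V G)
    (proj₁ (∧-true⁻ _ _ (trans (sym (lookup∘tabulate _ u)) ([]=⇒lookup u∈))))

removeEdges-twinPreserving : ∀ {n} (G : Graph n) {P Q : Subset n} →
  IsPart G P → IsPart G Q → TwinPreservingSubgraph (removeEdges G P Q) G
removeEdges-twinPreserving G {P} {Q} partP partQ = record
  { edge⊆       = λ uv → let u∈ , v∈ , a = E⁻ G′ uv in E⁺ G u∈ v∈ (proj₁ (∧-true⁻ _ _ a))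
  ; twin-extend = twin-extend
  }
  where
  G′ = removeEdges G P Q

  twin-extend : ∀ {a b w} → E G′ a b ≡ true → Twins G a b →
    E G′ a w ≡ true → E G b w ≡ true → E G′ b w ≡ true
  twin-extend {a} {b} {w} ab tw aw bw with E⁻ G′ ab | E⁻ G′ aw
  ... | a∈ , b∈ , _ | _ , w∈ , a-aw =
    E⁺ G′ b∈ w∈ (∧-true⁺ (proj₂ (proj₂ (E⁻ G bw))) (not-false⁺ b-not-crossing))
    where
    a-not-crossing : cross P Q a w ≡ false
    a-not-crossing = not-true⁻ _ (proj₂ (∧-true⁻ _ _ a-aw))
    b-not-crossing : cross P Q b w ≡ false
    b-not-crossing = trans
      (cong₂ (λ x y → (x ∧ lookup Q w) ∨ (y ∧ lookup P w))
             (sym (IsPart-lookup-twins G partP a∈ b∈ tw))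
             (sym (IsPart-lookup-twins G partQ a∈ b∈ tw)))
      a-not-crossing

lemma20 : ∀ {n h} (H : Graph h) (G : Graph n) →
    (∀ (P' : Subset n) → IsPart G P' → (∀ w → ¬ InNbr G P' w) →
    (∃[ ω ] (IsCliqueNumber H (λ u → u ∈ V H) ω × ∣ P' ∣ ≤ ω)) →
    ∀ (t t' : ℕ) → IsTau G t → IsTau (G － P') t' → t' ≤ t)
    ×
    (∀ (P' P'' : Subset n) → IsPart G P' → IsPart G P'' → P' ≢ P'' →
    EdgesBetweenNonempty G P' P'' →
    (∀ p → InL H P' G p → InSpan (InLΠ H G (removeEdges G P' P'')) p) →
    ∀ (t t' : ℕ) → IsTau G t → IsTau (removeEdges G P' P'') t' → t' ≤ t)
lemma20 H G =
    (λ P' _ _ _ _ _ → IsTau-mono (deleteVertices-twinPreserving G P'))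
  , (λ P' P'' partP' partP'' _ _ _ _ _ →
       IsTau-mono (removeEdges-twinPreserving G partP' partP''))
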